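{- Let $t\ge 2$, let $\mathcal{A}_1,\dots,\mathcal{A}_{t-1}$ be finite automata over the alphabet $\Sigma$, and let $M_1,\dots,M_{t-1},M_t$ be nonsingular matrices from $\mathbb{Z}^{2\times2}$. Then there is a finite automaton $\mathcal{B}$ over $\Sigma$ with the following properties: (1) if $w_1\in L(\mathcal{A}_1),\dots,w_{t-1}\in L(\mathcal{A}_{t-1})$ and there is $A\in\mathrm{GL}(2,\mathbb{Z})$ with $\phi(w_1)M_1\cdots\phi(w_{t-1})M_{t-1}A=M_t$, then there is $w\in L(\mathcal{B})$ with $\phi(w_1)M_1\cdots\phi(w_{t-1})M_{t-1}\phi(w)^{ -1}=M_t$; (2) if $w\in L(\mathcal{B})$, then there are $w_1\in L(\mathcal{A}_1),\dots,w_{t-1}\in L(\mathcal{A}_{t-1})$ with $\phi(w_1)M_1\cdots\phi(w_{t-1})M_{t-1}\phi(w)^{ -1}=M_t$.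
   Context: $\mathrm{GL}(2,\mathbb{Z})$ is the group of $2\times 2$ integer matrices with determinant $\pm1$. Let $\Sigma=\{X,N,S,R\}$ and $\phi:\Sigma^*\to\mathrm{GL}(2,\mathbb{Z})$ the monoid morphism determined by $\phi(X)=\begin{bmatrix}-1&0\\0&-1\end{bmatrix}$, $\phi(N)=\begin{bmatrix}1&0\\0&-1\end{bmatrix}$, $\phi(S)=\begin{bmatrix}0&-1\\1&0\end{bmatrix}$, $\phi(R)=\begin{bmatrix}0&-1\\1&1\end{bmatrix}$. $L(\mathcal{A})$ denotes the language accepted by an automaton $\mathcal{A}$. -}

module Defs where

open import Data.Nat using (ℕ; zero; suc)
open import Data.Integer using (ℤ; +_; -_; _+_; _-_; _*_; -1ℤ; 0ℤ; 1ℤ)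
open import Data.Fin using (Fin; zero; suc)
open import Data.List using (List; []; _∷_)
open import Data.Bool using (Bool; true)
open import Data.Product using (Σ; _×_; ∃)
open import Data.Sum using (_⊎_)
open import Relation.Binary.PropositionalEquality using (_≡_)
open import Relation.Nullary using (¬_)

record Mat : Set where
  constructor mat
  field
    a b c d : ℤ

infixl 7 _⊗_
_⊗_ : Mat → Mat → Mat
mat a b c d ⊗ mat a' b' c' d' =
  mat (a * a' + b * c') (a * b' + b * d') (c * a' + d * c') (c * b' + d * d')

I₂ : Mat
I₂ = mat 1ℤ 0ℤ 0ℤ 1ℤ

det : Mat → ℤ
det (mat a b c d) = a * d - b * c

Nonsingular : Mat → Set
Nonsingular M = ¬ (det M ≡ 0ℤ)

InGL2 : Mat → Set
InGL2 M = (det M ≡ 1ℤ) ⊎ (det M ≡ -1ℤ)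

-- inverse of a matrix of determinant ±1: det(M)⁻¹ · adj(M) = det(M) · adj(M)
inv : Mat → Mat
inv M@(mat a b c d) = mat (det M * d) (det M * (- b)) (det M * (- c)) (det M * a)

data Letter : Set where
  X N S R : Letter

φL : Letter → Mat
φL X = mat -1ℤ 0ℤ 0ℤ -1ℤ
φL N = mat 1ℤ 0ℤ 0ℤ -1ℤ
φL S = mat 0ℤ -1ℤ 1ℤ 0ℤ
φL R = mat 0ℤ -1ℤ 1ℤ 1ℤ

φ : List Letter → Mat
φ [] = I₂
φ (x ∷ w) = φL x ⊗ φ w

record NFA : Set where
  field
    states  : ℕ
    initial : Fin states → Bool
    final   : Fin states → Bool
    δ       : Fin states → Letter → Fin states → Bool

module _ (A : NFA) where
  open NFA A
  data Run : Fin states → List Letter → Fin states → Set where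
    done : ∀ {q} → Run q [] q
    step : ∀ {q q' q''} {x w} → δ q x q' ≡ true → Run q' w q'' → Run q (x ∷ w) q''

_∈L_ : List Letter → NFA → Set
w ∈L A = Σ (Fin (NFA.states A)) λ q₀ → Σ (Fin (NFA.states A)) λ q₁ →
  (NFA.initial A q₀ ≡ true) × Run A q₀ w q₁ × (NFA.final A q₁ ≡ true)

prod : (n : ℕ) → (Fin n → Mat) → Mat
prod zero f = I₂
prod (suc n) f = f zero ⊗ prod n (λ i → f (suc i))

-- An accepted word of ℬ is a concatenation of words u₀ u₁ … that trace the product
-- P = φ(w₁)M₁⋯φ(w_{t-1})M_{t-1} factor by factor while ℬ simulates the 𝒜ᵢ on guessed words wᵢ.
-- ℬ stores a matrix K, meaning that the unread input v must satisfy K φ(v) = (the factors of P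
-- still to come); consuming a factor G (some φ(x) with x a letter of wᵢ, or some Mᵢ) moves to
-- a matrix K′ with K φ(u) = G K′ for the next word u.  Taking K′ in Hermite normal form
-- [[a,0],[c,d]], 0 ≤ c < d, for right multiplication by φ(Σ*) = GL(2,ℤ) (Euclid's algorithm on
-- columns), and noting that |det K′| = |det| of the product of the remaining Mᵢ, only finitely
-- many K occur.  The first word u₀ must satisfy Mt φ(u₀) = K₀, i.e. φ(u₀) = Mt⁻¹K₀, and this matrix
-- lies in GL(2,ℤ) exactly when P ∈ Mt·GL(2,ℤ).

module Submission where

open import Defs
open import Data.Bool using (Bool; true; false)
import Data.Bool.Properties as Bool
open import Data.Fin as Fin
  using (Fin; zero; suc; toℕ; fromℕ; fromℕ<; inject₁; combine; remQuot; splitAt; join)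
import Data.Fin.Properties as Fin
open import Data.Fin.Induction using (>-weakInduction)
open import Data.Integer as ℤ
  using (ℤ; +_; +[1+_]; -_; -[1+_]; ∣_∣; 0ℤ; 1ℤ; -1ℤ; _+_; _-_; _*_; _/_; _%_; NonZero)
import Data.Integer.Properties as ℤ
open import Data.Integer.DivMod using (a≡a%n+[a/n]*n; n%d<d)
open import Data.Integer.Tactic.RingSolver using (solve-∀)
open import Data.List using (List; []; _∷_; _++_; length)
import Data.List.Properties as List
open import Data.List.NonEmpty using (List⁺; toList) renaming (_∷_ to _∷⁺_; tail to tail⁺)
open import Data.Nat as ℕ using (ℕ; zero; suc; _≤_; _<_; _∸_; z≤n; s≤s; _⊔_)
import Data.Nat.Properties as ℕ
open import Data.Nat.Divisibility using (_∣_; ∣-refl; ∣-trans; n∣m*n; ∣⇒≤; 0∣⇒≡0)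
open import Data.Product using (Σ; ∃; ∃₂; _×_; _,_)
open import Data.Sum using (_⊎_; inj₁; inj₂; [_,_])
open import Data.Unit using (⊤; tt)
open import Data.Vec.Functional using (updateAt)
open import Data.Vec.Functional.Properties using (updateAt-updates; updateAt-minimal)
open import Function using (_∘_; const)
open import Relation.Binary.Definitions using (DecidableEquality)
open import Relation.Binary.PropositionalEquality
  using (_≡_; _≢_; refl; sym; trans; cong; cong₂; subst; subst₂; ≢-sym; module ≡-Reasoning)
open import Relation.Nullary using (Dec; yes; no; does; contradiction)
open import Relation.Nullary.Decidable using (dec-true; _×-dec_)
import Relation.Unary as U

mat-cong : ∀ {a b c d a′ b′ c′ d′} → a ≡ a′ → b ≡ b′ → c ≡ c′ → d ≡ d′ →
           mat a b c d ≡ mat a′ b′ c′ d′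
mat-cong refl refl refl refl = refl

_≟ᴹ_ : (A B : Mat) → Dec (A ≡ B)
mat a b c d ≟ᴹ mat a′ b′ c′ d′
  with a ℤ.≟ a′ | b ℤ.≟ b′ | c ℤ.≟ c′ | d ℤ.≟ d′
... | yes refl | yes refl | yes refl | yes refl = yes refl
... | no a≢a′ | _        | _        | _        = no λ { refl → a≢a′ refl }
... | yes _   | no b≢b′ | _        | _        = no λ { refl → b≢b′ refl }
... | yes _   | yes _    | no c≢c′ | _        = no λ { refl → c≢c′ refl }
... | yes _   | yes _    | yes _    | no d≢d′ = no λ { refl → d≢d′ refl }

⊗-assoc : ∀ A B C → (A ⊗ B) ⊗ C ≡ A ⊗ (B ⊗ C)
⊗-assoc (mat a b c d) (mat e f g h) (mat i j k l) =
  mat-cong (entry a b e f g h i k) (entry a b e f g h j l)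
           (entry c d e f g h i k) (entry c d e f g h j l)
  where
  entry : ∀ a b e f g h i k →
          (a * e + b * g) * i + (a * f + b * h) * k ≡ a * (e * i + f * k) + b * (g * i + h * k)
  entry = solve-∀

⊗-identityˡ : ∀ A → I₂ ⊗ A ≡ A
⊗-identityˡ (mat a b c d) = mat-cong (entry a c) (entry b d) (entry′ a c) (entry′ b d)
  where
  entry : ∀ x y → 1ℤ * x + 0ℤ * y ≡ x
  entry = solve-∀
  entry′ : ∀ x y → 0ℤ * x + 1ℤ * y ≡ y
  entry′ = solve-∀

⊗-identityʳ : ∀ A → A ⊗ I₂ ≡ A
⊗-identityʳ (mat a b c d) = mat-cong (entry a b) (entry′ a b) (entry c d) (entry′ c d)
  where
  entry : ∀ x y → x * 1ℤ + y * 0ℤ ≡ x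
  entry = solve-∀
  entry′ : ∀ x y → x * 0ℤ + y * 1ℤ ≡ y
  entry′ = solve-∀

det-⊗ : ∀ A B → det (A ⊗ B) ≡ det A * det B
det-⊗ (mat a b c d) (mat e f g h) = cauchy-binet a b c d e f g h
  where
  cauchy-binet : ∀ a b c d e f g h →
    (a * e + b * g) * (c * f + d * h) - (a * f + b * h) * (c * e + d * g) ≡ (a * d - b * c) * (e * h - f * g)
  cauchy-binet = solve-∀

∣det∣-⊗ : ∀ A B → ∣ det (A ⊗ B) ∣ ≡ ∣ det A ∣ ℕ.* ∣ det B ∣
∣det∣-⊗ A B = trans (cong ∣_∣ (det-⊗ A B)) (ℤ.abs-* (det A) (det B))

IsUnit : ℤ → Set
IsUnit x = x ≡ 1ℤ ⊎ x ≡ -1ℤ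

unit-* : ∀ {x y} → IsUnit x → IsUnit y → IsUnit (x * y)
unit-* (inj₁ refl) (inj₁ refl) = inj₁ refl
unit-* (inj₁ refl) (inj₂ refl) = inj₂ refl
unit-* (inj₂ refl) (inj₁ refl) = inj₂ refl
unit-* (inj₂ refl) (inj₂ refl) = inj₁ refl

unit-*-self : ∀ {x} → IsUnit x → x * x ≡ 1ℤ
unit-*-self (inj₁ refl) = refl
unit-*-self (inj₂ refl) = refl

∣unit∣≡1 : ∀ {x} → IsUnit x → ∣ x ∣ ≡ 1
∣unit∣≡1 (inj₁ refl) = refl
∣unit∣≡1 (inj₂ refl) = refl

GL-⊗ : ∀ A B → InGL2 A → InGL2 B → InGL2 (A ⊗ B)
GL-⊗ A B gA gB = subst IsUnit (sym (det-⊗ A B)) (unit-* gA gB)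

⊗-inverseʳ : ∀ M → InGL2 M → M ⊗ inv M ≡ I₂
⊗-inverseʳ (mat a b c d) g =
  mat-cong (trans (diag a b c d) (unit-*-self g)) (off a b c d) (off′ a b c d)
           (trans (diag′ a b c d) (unit-*-self g))
  where
  diag : ∀ a b c d → a * ((a * d - b * c) * d) + b * ((a * d - b * c) * (- c)) ≡ (a * d - b * c) * (a * d - b * c)
  diag = solve-∀
  diag′ : ∀ a b c d → c * ((a * d - b * c) * (- b)) + d * ((a * d - b * c) * a) ≡ (a * d - b * c) * (a * d - b * c)
  diag′ = solve-∀
  off : ∀ a b c d → a * ((a * d - b * c) * (- b)) + b * ((a * d - b * c) * a) ≡ 0ℤ
  off = solve-∀
  off′ : ∀ a b c d → c * ((a * d - b * c) * d) + d * ((a * d - b * c) * (- c)) ≡ 0ℤ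
  off′ = solve-∀

inv-GL : ∀ M → InGL2 M → InGL2 (inv M)
inv-GL (mat a b c d) g = subst IsUnit (sym (det-inv a b c d)) (unit-* g (inj₁ (unit-*-self g)))
  where
  det-inv : ∀ a b c d →
    ((a * d - b * c) * d) * ((a * d - b * c) * a) - ((a * d - b * c) * (- b)) * ((a * d - b * c) * (- c))
      ≡ (a * d - b * c) * ((a * d - b * c) * (a * d - b * c))
  det-inv = solve-∀

⊗-cancelʳ : ∀ A G B → InGL2 G → A ⊗ G ≡ B → A ≡ B ⊗ inv G
⊗-cancelʳ A G B g AG≡B = begin
  A                  ≡⟨ sym (⊗-identityʳ A) ⟩
  A ⊗ I₂             ≡⟨ cong (A ⊗_) (sym (⊗-inverseʳ G g)) ⟩
  A ⊗ (G ⊗ inv G)    ≡⟨ sym (⊗-assoc A G (inv G)) ⟩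
  (A ⊗ G) ⊗ inv G    ≡⟨ cong (_⊗ inv G) AG≡B ⟩
  B ⊗ inv G          ∎
  where open ≡-Reasoning

∣det∣-⊗-GLʳ : ∀ A G → InGL2 G → ∣ det (A ⊗ G) ∣ ≡ ∣ det A ∣
∣det∣-⊗-GLʳ A G g = begin
  ∣ det (A ⊗ G) ∣          ≡⟨ ∣det∣-⊗ A G ⟩
  ∣ det A ∣ ℕ.* ∣ det G ∣  ≡⟨ cong (∣ det A ∣ ℕ.*_) (∣unit∣≡1 g) ⟩
  ∣ det A ∣ ℕ.* 1          ≡⟨ ℕ.*-identityʳ _ ⟩
  ∣ det A ∣                ∎
  where open ≡-Reasoning

∣det∣-⊗-GLˡ : ∀ G A → InGL2 G → ∣ det (G ⊗ A) ∣ ≡ ∣ det A ∣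
∣det∣-⊗-GLˡ G A g = begin
  ∣ det (G ⊗ A) ∣          ≡⟨ ∣det∣-⊗ G A ⟩
  ∣ det G ∣ ℕ.* ∣ det A ∣  ≡⟨ cong (ℕ._* ∣ det A ∣) (∣unit∣≡1 g) ⟩
  1 ℕ.* ∣ det A ∣          ≡⟨ ℕ.*-identityˡ _ ⟩
  ∣ det A ∣                ∎
  where open ≡-Reasoning

φ-++ : ∀ u v → φ (u ++ v) ≡ φ u ⊗ φ v
φ-++ []      v = sym (⊗-identityˡ (φ v))
φ-++ (x ∷ u) v = trans (cong (φL x ⊗_) (φ-++ u v)) (sym (⊗-assoc (φL x) (φ u) (φ v)))

φL-GL : ∀ x → InGL2 (φL x)
φL-GL X = inj₁ refl
φL-GL N = inj₂ refl
φL-GL S = inj₁ refl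
φL-GL R = inj₁ refl

φ-GL : ∀ w → InGL2 (φ w)
φ-GL []      = inj₁ refl
φ-GL (x ∷ w) = GL-⊗ (φL x) (φ w) (φL-GL x) (φ-GL w)

φ-XX : ∀ w → φ (X ∷ X ∷ w) ≡ φ w
φ-XX w = trans (sym (⊗-assoc (φL X) (φL X) (φ w))) (⊗-identityˡ (φ w))

⊗-φ-XX : ∀ A w {T} → A ⊗ φ w ≡ T → A ⊗ φ (X ∷ X ∷ w) ≡ T
⊗-φ-XX A w Aw≡T = trans (cong (A ⊗_) (φ-XX w)) Aw≡T

⊗φ⇒⊗inv : ∀ A w B → A ⊗ φ w ≡ B → B ⊗ inv (φ w) ≡ A
⊗φ⇒⊗inv A w B Aw≡B = sym (⊗-cancelʳ A (φ w) B (φ-GL w) Aw≡B)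

infix 4 _↝_
record _↝_ (A B : Mat) : Set where
  constructor _,_
  field
    word    : List Letter
    reaches : A ⊗ φ word ≡ B
open _↝_ public

↝-refl : ∀ A → A ↝ A
↝-refl A = [] , ⊗-identityʳ A

⊗-φ-++ : ∀ A {B C} u v → A ⊗ φ u ≡ B → B ⊗ φ v ≡ C → A ⊗ φ (u ++ v) ≡ C
⊗-φ-++ A {B} {C} u v Au≡B Bv≡C = begin
  A ⊗ φ (u ++ v)   ≡⟨ cong (A ⊗_) (φ-++ u v) ⟩
  A ⊗ (φ u ⊗ φ v)  ≡⟨ sym (⊗-assoc A (φ u) (φ v)) ⟩
  (A ⊗ φ u) ⊗ φ v  ≡⟨ cong (_⊗ φ v) Au≡B ⟩
  B ⊗ φ v          ≡⟨ Bv≡C ⟩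
  C                ∎
  where open ≡-Reasoning

↝-trans : ∀ {A B C} → A ↝ B → B ↝ C → A ↝ C
↝-trans {A} (u , Au≡B) (v , Bv≡C) = u ++ v , ⊗-φ-++ A u v Au≡B Bv≡C

↝-≡ : ∀ {A B C} → A ↝ B → B ≡ C → A ↝ C
↝-≡ A↝B refl = A↝B

shear⁺ : ℕ → List Letter
shear⁺ zero    = []
shear⁺ (suc n) = X ∷ S ∷ R ∷ R ∷ shear⁺ n

shear⁻ : ℕ → List Letter
shear⁻ zero    = X ∷ R ∷ S ∷ []
shear⁻ (suc n) = X ∷ R ∷ S ∷ shear⁻ n

shear : ℤ → List Letter
shear (+ n)    = shear⁺ n
shear -[1+ n ] = shear⁻ n

shear-+ : ∀ e k → mat 1ℤ 0ℤ e 1ℤ ⊗ mat 1ℤ 0ℤ k 1ℤ ≡ mat 1ℤ 0ℤ (e + k) 1ℤ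
shear-+ e k = mat-cong (entry k) refl (entry′ e k) (entry″ e)
  where
  entry : ∀ k → 1ℤ * 1ℤ + 0ℤ * k ≡ 1ℤ
  entry = solve-∀
  entry′ : ∀ e k → e * 1ℤ + 1ℤ * k ≡ e + k
  entry′ = solve-∀
  entry″ : ∀ e → e * 0ℤ + 1ℤ * 1ℤ ≡ 1ℤ
  entry″ = solve-∀

-- 1ℤ + + n and -1ℤ + -[1+ n ] compute to the next index, so no arithmetic lemma is needed.
φ-shear⁺ : ∀ n → φ (shear⁺ n) ≡ mat 1ℤ 0ℤ (+ n) 1ℤ
φ-shear⁺ zero    = refl
φ-shear⁺ (suc n) =
  trans (φ-++ (X ∷ S ∷ R ∷ R ∷ []) (shear⁺ n))
        (trans (cong (φ (X ∷ S ∷ R ∷ R ∷ []) ⊗_) (φ-shear⁺ n)) (shear-+ 1ℤ (+ n)))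

φ-shear⁻ : ∀ n → φ (shear⁻ n) ≡ mat 1ℤ 0ℤ -[1+ n ] 1ℤ
φ-shear⁻ zero    = refl
φ-shear⁻ (suc n) =
  trans (φ-++ (X ∷ R ∷ S ∷ []) (shear⁻ n))
        (trans (cong (φ (X ∷ R ∷ S ∷ []) ⊗_) (φ-shear⁻ n)) (shear-+ -1ℤ -[1+ n ]))

φ-shear : ∀ k → φ (shear k) ≡ mat 1ℤ 0ℤ k 1ℤ
φ-shear (+ n)    = φ-shear⁺ n
φ-shear -[1+ n ] = φ-shear⁻ n

shear-↝ : ∀ a b c d k → mat a b c d ↝ mat (a + b * k) b (c + d * k) d
shear-↝ a b c d k = shear k ,
  trans (cong (mat a b c d ⊗_) (φ-shear k)) (mat-cong (entry a b k) (entry′ a b) (entry c d k) (entry′ c d))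
  where
  entry : ∀ x y k → x * 1ℤ + y * k ≡ x + y * k
  entry = solve-∀
  entry′ : ∀ x y → x * 0ℤ + y * 1ℤ ≡ y
  entry′ = solve-∀

swap-↝ : ∀ a b c d → mat a b c d ↝ mat (- b) a (- d) c
swap-↝ a b c d = X ∷ S ∷ [] , mat-cong (entry a b) (entry′ a b) (entry c d) (entry′ c d)
  where
  entry : ∀ x y → x * (-1ℤ * 0ℤ + 0ℤ * 1ℤ + 0ℤ) + y * (0ℤ * 0ℤ + -1ℤ * 1ℤ + 0ℤ) ≡ - y
  entry = solve-∀
  entry′ : ∀ x y → x * (-1ℤ * -1ℤ + 0ℤ * 0ℤ + 0ℤ) + y * (0ℤ * -1ℤ + -1ℤ * 0ℤ + 0ℤ) ≡ x
  entry′ = solve-∀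

negate-↝ : ∀ a b c d → mat a b c d ↝ mat (- a) (- b) (- c) (- d)
negate-↝ a b c d = X ∷ [] , mat-cong (entry a b) (entry′ a b) (entry c d) (entry′ c d)
  where
  entry : ∀ x y → x * -1ℤ + y * 0ℤ ≡ - x
  entry = solve-∀
  entry′ : ∀ x y → x * 0ℤ + y * -1ℤ ≡ - y
  entry′ = solve-∀

negate₂-↝ : ∀ a b c d → mat a b c d ↝ mat a (- b) c (- d)
negate₂-↝ a b c d = N ∷ [] , mat-cong (entry a b) (entry′ a b) (entry c d) (entry′ c d)
  where
  entry : ∀ x y → x * 1ℤ + y * 0ℤ ≡ x
  entry = solve-∀
  entry′ : ∀ x y → x * 0ℤ + y * -1ℤ ≡ - y
  entry′ = solve-∀

-- Hermite normal form

LowerForm : Mat → Set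
LowerForm M = ∃₂ λ g r → ∃ λ s → mat g 0ℤ r s ↝ M

lowerForm-↝ : ∀ {A B} → LowerForm A → A ↝ B → LowerForm B
lowerForm-↝ (g , r , s , red) A↝B = g , r , s , ↝-trans red A↝B

euclid-step : ∀ p q r s .{{_ : NonZero q}} →
              mat q (- + (p % q)) s (- (r - (p / q) * s)) ↝ mat p q r s
euclid-step p q r s =
  ↝-≡ (↝-trans (swap-↝ q (- ρ) s (- r′)) (shear-↝ (- - ρ) q (- - r′) s k))
      (mat-cong (trans (entry ρ q k) (sym (a≡a%n+[a/n]*n p q))) refl (entry′ r s k) refl)
  where
  k ρ r′ : ℤ
  k  = p / q
  ρ  = + (p % q)
  r′ = r - k * s
  entry : ∀ ρ q k → - (- ρ) + q * k ≡ ρ + k * q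
  entry = solve-∀
  entry′ : ∀ r s k → - (- (r - k * s)) + s * k ≡ r
  entry′ = solve-∀

∣-remainder∣≤ : ∀ n p q .{{_ : NonZero q}} → ∣ q ∣ ≤ suc n → ∣ - + (p % q) ∣ ≤ n
∣-remainder∣≤ n p q ∣q∣≤ =
  subst (_≤ n) (sym (ℤ.∣-i∣≡∣i∣ (+ (p % q)))) (ℕ.s≤s⁻¹ (ℕ.<-≤-trans (n%d<d p q) ∣q∣≤))

mutual
  lowerForm : ∀ n p q r s → ∣ q ∣ ≤ n → LowerForm (mat p q r s)
  lowerForm _       p (+ zero)       r s _    = p , r , s , ↝-refl _
  lowerForm zero    p +[1+ _ ]       r s ()
  lowerForm zero    p -[1+ _ ]       r s ()
  lowerForm (suc n) p q@(+[1+ _ ])   r s ∣q∣≤ = euclid n p q r s ∣q∣≤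
  lowerForm (suc n) p q@(-[1+ _ ])   r s ∣q∣≤ = euclid n p q r s ∣q∣≤

  euclid : ∀ n p q r s .{{_ : NonZero q}} → ∣ q ∣ ≤ suc n → LowerForm (mat p q r s)
  euclid n p q r s ∣q∣≤ =
    lowerForm-↝ (lowerForm n q (- + (p % q)) s (- (r - (p / q) * s)) (∣-remainder∣≤ n p q ∣q∣≤))
                (euclid-step p q r s)

record HermiteForm (M : Mat) : Set where
  constructor hermite
  field
    a d     : ℕ
    c       : ℤ
    reduces : mat (+ a) 0ℤ c (+ d) ↝ M
    reduced : 0 < d → ∃ λ c′ → c ≡ + c′ × c′ < d

reduce-mod : ∀ {M} a r d → mat (+ a) 0ℤ r (+ d) ↝ M → HermiteForm M
reduce-mod a r zero    red = hermite a zero r red λ ()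
reduce-mod a r (suc d) red = hermite a (suc d) (+ (r % D))
  (↝-trans (↝-≡ (shear-↝ (+ a) 0ℤ (+ (r % D)) D (r / D))
                (mat-cong (entry (+ a) (r / D)) refl
                          (trans (entry′ (+ (r % D)) D (r / D)) (sym (a≡a%n+[a/n]*n r D))) refl))
           red)
  (λ _ → r % D , refl , n%d<d r D)
  where
  D : ℤ
  D = +[1+ d ]
  entry : ∀ a k → a + 0ℤ * k ≡ a
  entry = solve-∀
  entry′ : ∀ c d k → c + d * k ≡ c + k * d
  entry′ = solve-∀

hermite-nonneg-first : ∀ {M} a r s → mat (+ a) 0ℤ r s ↝ M → HermiteForm M
hermite-nonneg-first a r (+ d)    red = reduce-mod a r d red
hermite-nonneg-first a r -[1+ d ] red = reduce-mod a r (suc d) (↝-trans (negate₂-↝ (+ a) 0ℤ r +[1+ d ]) red)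

hermite-lower : ∀ {M} g r s → mat g 0ℤ r s ↝ M → HermiteForm M
hermite-lower (+ a)    r s red = hermite-nonneg-first a r s red
hermite-lower -[1+ a ] r s red = hermite-nonneg-first (suc a) (- r) (- s)
  (↝-trans (↝-≡ (negate-↝ +[1+ a ] 0ℤ (- r) (- s))
                (mat-cong refl refl (ℤ.neg-involutive r) (ℤ.neg-involutive s)))
           red)

hermiteForm : ∀ M → HermiteForm M
hermiteForm (mat p q r s) with lowerForm ∣ q ∣ p q r s ℕ.≤-refl
... | g , r′ , s′ , red = hermite-lower g r′ s′ red

hermite-det : ∀ {M} (H : HermiteForm M) → HermiteForm.a H ℕ.* HermiteForm.d H ≡ ∣ det M ∣
hermite-det {M} (hermite a d c (u , eq) _) = begin
  a ℕ.* d                                 ≡⟨ ℤ.abs-* (+ a) (+ d) ⟨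
  ∣ + a * + d ∣                           ≡⟨ cong ∣_∣ (entry (+ a * + d) c) ⟨
  ∣ det (mat (+ a) 0ℤ c (+ d)) ∣          ≡⟨ ∣det∣-⊗-GLʳ (mat (+ a) 0ℤ c (+ d)) (φ u) (φ-GL u) ⟨
  ∣ det (mat (+ a) 0ℤ c (+ d) ⊗ φ u) ∣    ≡⟨ cong (λ A → ∣ det A ∣) eq ⟩
  ∣ det M ∣                               ∎
  where
  open ≡-Reasoning
  entry : ∀ x y → x - 0ℤ * y ≡ x
  entry = solve-∀

hermite-GL : ∀ {M} → InGL2 M → (H : HermiteForm M) → φ (word (HermiteForm.reduces H)) ≡ M
hermite-GL g H@(hermite a d c (u , eq) reduced)
  with refl ← ℕ.m*n≡1⇒m≡1 a d (trans (hermite-det H) (∣unit∣≡1 g))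
     | refl ← ℕ.m*n≡1⇒n≡1 a d (trans (hermite-det H) (∣unit∣≡1 g))
  with c′ , refl , c′<1 ← reduced ℕ.z<s
  with refl ← ℕ.n<1⇒n≡0 c′<1
  = trans (sym (⊗-identityˡ (φ u))) eq

Triangle : ℕ → Set
Triangle D = Fin (suc D) × Fin (suc D) × Fin (suc D)

triangle : ∀ {D} → Triangle D → Mat
triangle (a , c , d) = mat (+ toℕ a) 0ℤ (+ toℕ c) (+ toℕ d)

hermite-bounded : ∀ {M} D → ∣ det M ∣ ≢ 0 → ∣ det M ∣ ≤ D → (H : HermiteForm M) →
                  Σ (Triangle D) λ k → triangle k ⊗ φ (word (HermiteForm.reduces H)) ≡ M
hermite-bounded D nz det≤D H@(hermite zero d c _ _) = contradiction (sym (hermite-det H)) nz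
hermite-bounded D nz det≤D H@(hermite a zero c _ _) = contradiction (trans (sym (hermite-det H)) (ℕ.*-zeroʳ a)) nz
hermite-bounded D nz det≤D H@(hermite a@(suc _) d@(suc _) _ (u , eq) reduced)
  with reduced ℕ.z<s
... | c , refl , c<d = k , trans (cong (_⊗ φ u) triangle-k) eq
  where
  ad≤D : a ℕ.* d ≤ D
  ad≤D = subst (_≤ D) (sym (hermite-det H)) det≤D
  a<1+D : a < suc D
  a<1+D = s≤s (ℕ.≤-trans (ℕ.m≤m*n a d) ad≤D)
  d<1+D : d < suc D
  d<1+D = s≤s (ℕ.≤-trans (ℕ.m≤n*m d a) ad≤D)
  c<1+D : c < suc D
  c<1+D = ℕ.<-trans c<d d<1+D
  k : Triangle D
  k = fromℕ< a<1+D , fromℕ< c<1+D , fromℕ< d<1+D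
  triangle-k : triangle k ≡ mat (+ a) 0ℤ (+ c) (+ d)
  triangle-k = mat-cong (cong +_ (Fin.toℕ-fromℕ< a<1+D)) refl
                        (cong +_ (Fin.toℕ-fromℕ< c<1+D)) (cong +_ (Fin.toℕ-fromℕ< d<1+D))

-- Opaque, so that type checking never runs the Euclidean reduction on symbolic matrices.
opaque
  hermiteWord : Mat → List Letter
  hermiteWord M = word (HermiteForm.reduces (hermiteForm M))

  φ-surjective : ∀ M → InGL2 M → φ (hermiteWord M) ≡ M
  φ-surjective M g = hermite-GL g (hermiteForm M)

  hermiteWord-bounded : ∀ {M} D → ∣ det M ∣ ≢ 0 → ∣ det M ∣ ≤ D →
                        Σ (Triangle D) λ k → triangle k ⊗ φ (hermiteWord M) ≡ M
  hermiteWord-bounded {M} D nz det≤D = hermite-bounded D nz det≤D (hermiteForm M)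

i*j/i≡j : ∀ d x .{{_ : NonZero d}} → (d * x) / d ≡ x
i*j/i≡j d x =
  sym (ℤ.i-j≡0⇒i≡j x q (ℤ.∣i∣≡0⇒i≡0 (ℕ.n<1⇒n≡0 (ℕ.*-cancelˡ-< ∣ d ∣ ∣ x - q ∣ 1 ∣d[x-q]∣<∣d∣))))
  where
  q : ℤ
  q = (d * x) / d
  ρ : ℕ
  ρ = (d * x) % d
  ρ≡d[x-q] : + ρ ≡ d * (x - q)
  ρ≡d[x-q] = trans (sym (entry (+ ρ) q d))
                   (trans (cong (_- q * d) (sym (a≡a%n+[a/n]*n (d * x) d))) (entry′ d x q))
    where
    entry : ∀ ρ q d → (ρ + q * d) - q * d ≡ ρ
    entry = solve-∀
    entry′ : ∀ d x q → d * x - q * d ≡ d * (x - q)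
    entry′ = solve-∀
  ∣d[x-q]∣<∣d∣ : ∣ d ∣ ℕ.* ∣ x - q ∣ < ∣ d ∣ ℕ.* 1
  ∣d[x-q]∣<∣d∣ = subst₂ _<_ (trans (cong ∣_∣ ρ≡d[x-q]) (ℤ.abs-* d (x - q)))
                            (sym (ℕ.*-identityʳ ∣ d ∣))
                            (n%d<d (d * x) d)

adj : Mat → Mat
adj (mat a b c d) = mat d (- b) (- c) a

_·_ : ℤ → Mat → Mat
x · mat a b c d = mat (x * a) (x * b) (x * c) (x * d)

adj-⊗ : ∀ M H → adj M ⊗ (M ⊗ H) ≡ det M · H
adj-⊗ (mat a b c d) (mat e f g h) =
  mat-cong (entry a b c d e g) (entry a b c d f h) (entry′ a b c d e g) (entry′ a b c d f h)
  where
  entry : ∀ a b c d e g → d * (a * e + b * g) + (- b) * (c * e + d * g) ≡ (a * d - b * c) * e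
  entry = solve-∀
  entry′ : ∀ a b c d e g → (- c) * (a * e + b * g) + a * (c * e + d * g) ≡ (a * d - b * c) * g
  entry′ = solve-∀

_÷_ : Mat → (x : ℤ) .{{_ : NonZero x}} → Mat
mat a b c d ÷ x = mat (a / x) (b / x) (c / x) (d / x)

·-÷ : ∀ x .{{_ : NonZero x}} H → (x · H) ÷ x ≡ H
·-÷ x (mat a b c d) = mat-cong (i*j/i≡j x a) (i*j/i≡j x b) (i*j/i≡j x c) (i*j/i≡j x d)

-- Entries are divided with truncation, so M ∖ K is M⁻¹ K only when the latter is integral (∖-⊗).
_∖_ : (M : Mat) .{{_ : NonZero (det M)}} → Mat → Mat
M ∖ K = (adj M ⊗ K) ÷ det M

∖-⊗ : ∀ M .{{_ : NonZero (det M)}} H → M ∖ (M ⊗ H) ≡ H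
∖-⊗ M H = begin
  (adj M ⊗ (M ⊗ H)) ÷ det M  ≡⟨ cong (_÷ det M) (adj-⊗ M H) ⟩
  (det M · H) ÷ det M        ≡⟨ ·-÷ (det M) H ⟩
  H                          ∎
  where open ≡-Reasoning

record Finite (A : Set) : Set where
  field
    size       : ℕ
    enum       : Fin size → A
    index      : A → Fin size
    enum-index : ∀ a → enum (index a) ≡ a

open Finite

finite-Fin : ∀ n → Finite (Fin n)
finite-Fin n = record { size = n ; enum = λ i → i ; index = λ i → i ; enum-index = λ _ → refl }

finite-⊤ : Finite ⊤
finite-⊤ = record { size = 1 ; enum = λ _ → tt ; index = λ _ → zero ; enum-index = λ _ → refl }

finite-retract : ∀ {A B : Set} → Finite A → (f : A → B) (g : B → A) → (∀ b → f (g b) ≡ b) → Finite B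
finite-retract fA f g fg = record
  { size = size fA ; enum = λ i → f (enum fA i) ; index = λ b → index fA (g b)
  ; enum-index = λ b → trans (cong f (enum-index fA (g b))) (fg b) }

finite-× : ∀ {A B : Set} → Finite A → Finite B → Finite (A × B)
finite-× fA fB = record
  { size       = size fA ℕ.* size fB
  ; enum       = λ i → let (j , k) = remQuot (size fB) i in enum fA j , enum fB k
  ; index      = λ (a , b) → combine (index fA a) (index fB b)
  ; enum-index = λ (a , b) → begin
      _ ≡⟨ cong (λ (j , k) → enum fA j , enum fB k) (Fin.remQuot-combine (index fA a) (index fB b)) ⟩
      enum fA (index fA a) , enum fB (index fB b) ≡⟨ cong₂ _,_ (enum-index fA a) (enum-index fB b) ⟩
      a , b ∎ }
  where open ≡-Reasoning

finite-⊎ : ∀ {A B : Set} → Finite A → Finite B → Finite (A ⊎ B)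
finite-⊎ {A} {B} fA fB = record
  { size       = size fA ℕ.+ size fB
  ; enum       = λ i → enum⊎ (splitAt (size fA) i)
  ; index      = λ x → join (size fA) (size fB) (index⊎ x)
  ; enum-index = λ x → trans (cong enum⊎ (Fin.splitAt-join (size fA) (size fB) (index⊎ x))) (enum-index⊎ x) }
  where
  enum⊎ : Fin (size fA) ⊎ Fin (size fB) → A ⊎ B
  enum⊎ (inj₁ i) = inj₁ (enum fA i)
  enum⊎ (inj₂ j) = inj₂ (enum fB j)
  index⊎ : A ⊎ B → Fin (size fA) ⊎ Fin (size fB)
  index⊎ (inj₁ a) = inj₁ (index fA a)
  index⊎ (inj₂ b) = inj₂ (index fB b)
  enum-index⊎ : ∀ x → enum⊎ (index⊎ x) ≡ x
  enum-index⊎ (inj₁ a) = cong inj₁ (enum-index fA a)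
  enum-index⊎ (inj₂ b) = cong inj₂ (enum-index fB b)

finite-Σ : ∀ k {P : Fin k → Set} → (∀ i → Finite (P i)) → Finite (Σ (Fin k) P)
finite-Σ zero    fP = record { size = 0 ; enum = λ () ; index = λ () ; enum-index = λ () }
finite-Σ (suc k) {P} fP =
  finite-retract (finite-⊎ (fP zero) (finite-Σ k (λ i → fP (suc i)))) from⊎ to⊎ from-to
  where
  from⊎ : P zero ⊎ Σ (Fin k) (λ i → P (suc i)) → Σ (Fin (suc k)) P
  from⊎ (inj₁ p)       = zero , p
  from⊎ (inj₂ (i , p)) = suc i , p
  to⊎ : Σ (Fin (suc k)) P → P zero ⊎ Σ (Fin k) (λ i → P (suc i))
  to⊎ (zero , p)  = inj₁ p
  to⊎ (suc i , p) = inj₂ (i , p)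
  from-to : ∀ x → from⊎ (to⊎ x) ≡ x
  from-to (zero , p)  = refl
  from-to (suc i , p) = refl

Bounded : Set → ℕ → Set
Bounded A L = Σ (List A) λ xs → length xs ≤ L

finite-Bounded : ∀ {A} → Finite A → ∀ L → Finite (Bounded A L)
finite-Bounded fA zero    = finite-retract finite-⊤ (λ _ → [] , z≤n) (λ _ → tt) λ { ([] , z≤n) → refl }
finite-Bounded {A} fA (suc L) =
  finite-retract (finite-⊎ finite-⊤ (finite-× fA (finite-Bounded fA L))) from⊎ to⊎ from-to
  where
  from⊎ : ⊤ ⊎ (A × Bounded A L) → Bounded A (suc L)
  from⊎ (inj₁ _)               = [] , z≤n
  from⊎ (inj₂ (x , xs , ∣xs∣≤)) = x ∷ xs , s≤s ∣xs∣≤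
  to⊎ : Bounded A (suc L) → ⊤ ⊎ (A × Bounded A L)
  to⊎ ([] , _)              = inj₁ tt
  to⊎ (x ∷ xs , s≤s ∣xs∣≤) = inj₂ (x , xs , ∣xs∣≤)
  from-to : ∀ xs → from⊎ (to⊎ xs) ≡ xs
  from-to ([] , z≤n)          = refl
  from-to (x ∷ xs , s≤s _)    = refl

finite-≟ : ∀ {A} → Finite A → DecidableEquality A
finite-≟ fA a b with index fA a Fin.≟ index fA b
... | yes i≡j = yes (trans (sym (enum-index fA a)) (trans (cong (enum fA) i≡j) (enum-index fA b)))
... | no  i≢j = no λ a≡b → i≢j (cong (index fA) a≡b)

finite-any? : ∀ {A} {P : A → Set} → Finite A → U.Decidable P → Dec (∃ P)
finite-any? {P = P} fA P? with Fin.any? (λ i → P? (enum fA i))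
... | yes (i , p) = yes (enum fA i , p)
... | no  ¬p      = no λ (a , p) → ¬p (index fA a , subst P (sym (enum-index fA a)) p)

maxOver : ∀ n → (Fin n → ℕ) → ℕ
maxOver zero    f = 0
maxOver (suc n) f = f zero ⊔ maxOver n (λ i → f (suc i))

≤-maxOver : ∀ n (f : Fin n → ℕ) i → f i ≤ maxOver n f
≤-maxOver (suc n) f zero    = ℕ.m≤m⊔n _ _
≤-maxOver (suc n) f (suc i) = ℕ.≤-trans (≤-maxOver n (λ i → f (suc i)) i) (ℕ.m≤n⊔m _ _)

finite-Letter : Finite Letter
finite-Letter = finite-retract (finite-Fin 4) letter code letter-code
  where
  letter : Fin 4 → Letter
  letter zero                   = X
  letter (suc zero)             = N
  letter (suc (suc zero))       = S
  letter (suc (suc (suc zero))) = R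
  code : Letter → Fin 4
  code X = zero
  code N = suc zero
  code S = suc (suc zero)
  code R = suc (suc (suc zero))
  letter-code : ∀ x → letter (code x) ≡ x
  letter-code X = refl
  letter-code N = refl
  letter-code S = refl
  letter-code R = refl

finite-Triangle : ∀ D → Finite (Triangle D)
finite-Triangle D = finite-× (finite-Fin (suc D)) (finite-× (finite-Fin (suc D)) (finite-Fin (suc D)))

_≟ᴸ_ : DecidableEquality Letter
_≟ᴸ_ = finite-≟ finite-Letter

dec-true⁻¹ : ∀ {P : Set} (P? : Dec P) → does P? ≡ true → P
dec-true⁻¹ (yes p) _  = p
dec-true⁻¹ (no _)  ()

-- Automata whose edges read nonempty words

record WordAutomaton : Set₁ where
  field
    State Edge    : Set
    finite-State  : Finite State
    finite-Edge   : Finite Edge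
    Valid         : Edge → Set
    valid?        : U.Decidable Valid
    source target : Edge → State
    label         : Edge → List⁺ Letter
    initial final : State → Bool

module WordAutomaton-NFA (𝒲 : WordAutomaton) where
  open WordAutomaton 𝒲

  data Path : State → List Letter → State → Set where
    []   : ∀ {q} → Path q [] q
    edge : ∀ {q w q′} e → Valid e → source e ≡ q → Path (target e) w q′ →
           Path q (toList (label e) ++ w) q′

  Accepts : List Letter → Set
  Accepts w = ∃₂ λ q₀ q₁ → initial q₀ ≡ true × Path q₀ w q₁ × final q₁ ≡ true

  bound : ℕ
  bound = maxOver (size finite-Edge) λ i → length (tail⁺ (label (enum finite-Edge i)))

  ∣tail∣≤bound : ∀ e → length (tail⁺ (label e)) ≤ bound
  ∣tail∣≤bound e = subst (λ e → length (tail⁺ (label e)) ≤ bound) (enum-index finite-Edge e)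
                     (≤-maxOver _ _ (index finite-Edge e))

  -- A configuration (q , r) is in the middle of an edge into q, with r still to be read.
  Config : Set
  Config = State × Bounded Letter bound

  finite-Config : Finite Config
  finite-Config = finite-× finite-State (finite-Bounded finite-Letter bound)

  Step : Config → Letter → Config → Set
  Step (q , []    , _) x (q′ , r′ , _) =
    ∃ λ e → Valid e × source e ≡ q × target e ≡ q′ × toList (label e) ≡ x ∷ r′
  Step (q , y ∷ r , _) x (q′ , r′ , _) = q ≡ q′ × y ≡ x × r ≡ r′

  _≟ˢ_ : DecidableEquality State
  _≟ˢ_ = finite-≟ finite-State

  _≟ʷ_ : DecidableEquality (List Letter)
  _≟ʷ_ = List.≡-dec _≟ᴸ_

  step? : ∀ c x c′ → Dec (Step c x c′)
  step? (q , []    , _) x (q′ , r′ , _) = finite-any? finite-Edge λ e →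
    valid? e ×-dec (source e ≟ˢ q) ×-dec (target e ≟ˢ q′) ×-dec (toList (label e) ≟ʷ (x ∷ r′))
  step? (q , y ∷ r , _) x (q′ , r′ , _) = (q ≟ˢ q′) ×-dec (y ≟ᴸ x) ×-dec (r ≟ʷ r′)

  settled : (State → Bool) → Config → Bool
  settled p (q , []    , _) = p q
  settled p (q , _ ∷ _ , _) = false

  nfa : NFA
  nfa = record
    { states  = size finite-Config
    ; initial = λ i → settled initial (enum finite-Config i)
    ; final   = λ i → settled final (enum finite-Config i)
    ; δ       = λ i x j → does (step? (enum finite-Config i) x (enum finite-Config j))
    }

  ⌜_⌝ : Config → Fin (size finite-Config)
  ⌜_⌝ = index finite-Config

  at : State → Config
  at q = q , [] , z≤n

  step⇒δ : ∀ {c x c′} → Step c x c′ → NFA.δ nfa ⌜ c ⌝ x ⌜ c′ ⌝ ≡ true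
  step⇒δ {c} {x} {c′} s = dec-true (step? _ x _)
    (subst₂ (λ c c′ → Step c x c′) (sym (enum-index finite-Config c)) (sym (enum-index finite-Config c′)) s)

  pending⇒run : ∀ {q w q′} r (∣r∣≤bound : length r ≤ bound) →
                Run nfa ⌜ at q ⌝ w ⌜ at q′ ⌝ → Run nfa ⌜ q , r , ∣r∣≤bound ⌝ (r ++ w) ⌜ at q′ ⌝
  pending⇒run []      z≤n     run = run
  pending⇒run (y ∷ r) ∣y∷r∣≤bound run =
    step (step⇒δ (refl , refl , refl)) (pending⇒run r (ℕ.<⇒≤ ∣y∷r∣≤bound) run)

  path⇒run : ∀ {q w q′} → Path q w q′ → Run nfa ⌜ at q ⌝ w ⌜ at q′ ⌝
  path⇒run []                   = done
  path⇒run (edge e v refl path) with label e in label≡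
  ... | x ∷⁺ r = step (step⇒δ (e , v , refl , refl , cong toList label≡))
                      (pending⇒run r (subst (λ l → length (tail⁺ l) ≤ bound) label≡ (∣tail∣≤bound e))
                                     (path⇒run path))

  AcceptsFrom : Config → List Letter → Set
  AcceptsFrom (q , r , _) w = ∃₂ λ w′ q′ → w ≡ r ++ w′ × Path q w′ q′ × final q′ ≡ true

  settled-accepts : ∀ c → settled final c ≡ true → AcceptsFrom c []
  settled-accepts (q , [] , _) final≡ = [] , q , refl , [] , final≡

  step-back : ∀ {c x c′ w} → Step c x c′ → AcceptsFrom c′ w → AcceptsFrom c (x ∷ w)
  step-back {q , [] , _} (e , v , refl , refl , label≡) (w′ , q′ , refl , path , final≡) =
    toList (label e) ++ w′ , q′ , cong (_++ w′) (sym label≡) , edge e v refl path , final≡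
  step-back {q , y ∷ r , _} (refl , refl , refl) (w′ , q′ , refl , path , final≡) =
    w′ , q′ , refl , path , final≡

  run⇒accepts : ∀ {i w j} → Run nfa i w j → NFA.final nfa j ≡ true → AcceptsFrom (enum finite-Config i) w
  run⇒accepts {i} done final≡ = settled-accepts (enum finite-Config i) final≡
  run⇒accepts (step {x = x} δ≡true run) final≡ =
    step-back (dec-true⁻¹ (step? _ x _) δ≡true) (run⇒accepts run final≡)

  accepts⇒∈L : ∀ {w} → Accepts w → w ∈L nfa
  accepts⇒∈L (q₀ , q₁ , initial≡ , path , final≡) =
    ⌜ at q₀ ⌝ , ⌜ at q₁ ⌝ ,
    trans (cong (settled initial) (enum-index finite-Config _)) initial≡ ,
    path⇒run path ,
    trans (cong (settled final) (enum-index finite-Config _)) final≡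

  initial-accepts : ∀ c {w} → settled initial c ≡ true → AcceptsFrom c w → Accepts w
  initial-accepts (q , [] , _) initial≡ (w′ , q′ , refl , path , final≡) = q , q′ , initial≡ , path , final≡

  ∈L⇒accepts : ∀ {w} → w ∈L nfa → Accepts w
  ∈L⇒accepts (i , j , initial≡ , run , final≡) =
    initial-accepts (enum finite-Config i) initial≡ (run⇒accepts run final≡)

prodAfter : ∀ {n} → (Fin n → Mat) → Fin n → Mat
prodAfter {suc n} f zero    = prod n (f ∘ suc)
prodAfter {suc n} f (suc i) = prodAfter (f ∘ suc) i

prodFrom : ∀ {n} → (Fin n → Mat) → Fin n → Mat
prodFrom f i = f i ⊗ prodAfter f i

prod-cong : ∀ n {f g : Fin n → Mat} → (∀ j → f j ≡ g j) → prod n f ≡ prod n g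
prod-cong zero    f≗g = refl
prod-cong (suc n) f≗g = cong₂ _⊗_ (f≗g zero) (prod-cong n (f≗g ∘ suc))

prodAfter-cong : ∀ {n} {f g : Fin n → Mat} i → (∀ j → i Fin.< j → f j ≡ g j) →
                 prodAfter f i ≡ prodAfter g i
prodAfter-cong {suc n} zero    f≗g = prod-cong n λ j → f≗g (suc j) ℕ.z<s
prodAfter-cong {suc n} (suc i) f≗g = prodAfter-cong i λ j i<j → f≗g (suc j) (ℕ.s<s i<j)

prodAfter-inject₁ : ∀ {n} (f : Fin (suc n) → Mat) j → prodAfter f (inject₁ j) ≡ prodFrom f (suc j)
prodAfter-inject₁ {suc n} f zero    = refl
prodAfter-inject₁ {suc n} f (suc j) = prodAfter-inject₁ (f ∘ suc) j

prodAfter-last : ∀ n (f : Fin (suc n) → Mat) → prodAfter f (fromℕ n) ≡ I₂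
prodAfter-last zero    f = refl
prodAfter-last (suc n) f = prodAfter-last n (f ∘ suc)

∣det∣-prodFrom-divides : ∀ {n} (f : Fin n → Mat) i → ∣ det (prodFrom f i) ∣ ∣ ∣ det (prod n f) ∣
∣det∣-prodFrom-divides {suc n} f zero    = ∣-refl
∣det∣-prodFrom-divides {suc n} f (suc i) =
  ∣-trans (∣det∣-prodFrom-divides (f ∘ suc) i)
          (subst (∣ det (prod n (f ∘ suc)) ∣ ∣_) (sym (∣det∣-⊗ (f zero) (prod n (f ∘ suc))))
                 (n∣m*n ∣ det (f zero) ∣))

nonsingular-⊗ : ∀ A B → Nonsingular A → Nonsingular B → Nonsingular (A ⊗ B)
nonsingular-⊗ A B A≢0 B≢0 = [ A≢0 , B≢0 ] ∘ ℤ.i*j≡0⇒i≡0∨j≡0 (det A) ∘ trans (sym (det-⊗ A B))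

nonsingular-prod : ∀ n (f : Fin n → Mat) → (∀ j → Nonsingular (f j)) → Nonsingular (prod n f)
nonsingular-prod zero    f nonsingular ()
nonsingular-prod (suc n) f nonsingular =
  nonsingular-⊗ (f zero) (prod n (f ∘ suc)) (nonsingular zero) (nonsingular-prod n (f ∘ suc) (nonsingular ∘ suc))

inject₁<⇒≡suc⊎suc< : ∀ {n} {j : Fin n} {l} → inject₁ j Fin.< l → l ≡ suc j ⊎ suc j Fin.< l
inject₁<⇒≡suc⊎suc< {j = j} {l} j<l with ℕ.m≤n⇒m<n∨m≡n (subst (ℕ._< toℕ l) (Fin.toℕ-inject₁ j) j<l)
... | inj₁ suc-j<l = inj₂ suc-j<l
... | inj₂ suc-j≡l = inj₁ (Fin.toℕ-injective (sym suc-j≡l))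

-- The automaton ℬ

module Construction {m : ℕ} (𝒜 : Fin (suc m) → NFA) (M : Fin (suc m) → Mat) (Mt : Mat)
                    (M-nonsingular : ∀ i → Nonsingular (M i)) (Mt-nonsingular : Nonsingular Mt) where

  Q : Fin (suc m) → ℕ
  Q i = NFA.states (𝒜 i)

  last : Fin (suc m)
  last = fromℕ m

  D : ℕ
  D = ∣ det (prod (suc m) M) ∣

  Dᵢ : Fin (suc m) → ℕ
  Dᵢ i = ∣ det (prodFrom M i) ∣

  D≢0 : D ≢ 0
  D≢0 = nonsingular-prod (suc m) M M-nonsingular ∘ ℤ.∣i∣≡0⇒i≡0

  Dᵢ≢0 : ∀ i → Dᵢ i ≢ 0
  Dᵢ≢0 i Dᵢ≡0 = D≢0 (0∣⇒≡0 (subst (_∣ D) Dᵢ≡0 (∣det∣-prodFrom-divides M i)))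

  Dᵢ≤D : ∀ i → Dᵢ i ≤ D
  Dᵢ≤D i = ∣⇒≤ {{ℕ.≢-nonZero D≢0}} (∣det∣-prodFrom-divides M i)

  Dᵢ-inject₁ : ∀ j → Dᵢ (inject₁ j) ≡ ∣ det (M (inject₁ j)) ∣ ℕ.* Dᵢ (suc j)
  Dᵢ-inject₁ j = trans (∣det∣-⊗ (M (inject₁ j)) (prodAfter M (inject₁ j)))
                       (cong (λ P → ∣ det (M (inject₁ j)) ∣ ℕ.* ∣ det P ∣) (prodAfter-inject₁ M j))

  Dᵢ-last : Dᵢ last ≡ ∣ det (M last) ∣
  Dᵢ-last = cong (λ P → ∣ det P ∣) (trans (cong (M last ⊗_) (prodAfter-last m M)) (⊗-identityʳ (M last)))

  HermiteTriangle : Fin (suc m) → Mat → Set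
  HermiteTriangle i T =
    Σ (Triangle D) λ k → triangle k ⊗ φ (hermiteWord T) ≡ T × ∣ det (triangle k) ∣ ≡ Dᵢ i

  triangle-for : ∀ i T → ∣ det T ∣ ≡ Dᵢ i → HermiteTriangle i T
  triangle-for i T ∣T∣≡Dᵢ =
    with-det (hermiteWord-bounded D (λ ∣T∣≡0 → Dᵢ≢0 i (trans (sym ∣T∣≡Dᵢ) ∣T∣≡0))
                                    (subst (_≤ D) (sym ∣T∣≡Dᵢ) (Dᵢ≤D i)))
    where
    with-det : Σ (Triangle D) (λ k → triangle k ⊗ φ (hermiteWord T) ≡ T) → HermiteTriangle i T
    with-det (k , reduces) = k , reduces ,
      trans (sym (∣det∣-⊗-GLʳ (triangle k) (φ (hermiteWord T)) (φ-GL (hermiteWord T))))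
            (trans (cong (λ A → ∣ det A ∣) reduces) ∣T∣≡Dᵢ)

  instance
    det-Mt≢0 : NonZero (det Mt)
    det-Mt≢0 = ℤ.≢-nonZero Mt-nonsingular

  -- In middle i q k, ℬ simulates 𝒜 i in state q, and its unread input v must satisfy
  -- triangle k ⊗ φ v ≡ φ w′ ⊗ M i ⊗ φ wᵢ₊₁ ⊗ M (i + 1) ⊗ ⋯ ⊗ M last, with w′ the unread part of wᵢ.
  data State : Set where
    start accept : State
    middle       : ∀ i → Fin (Q i) → Triangle D → State

  data Edge : Set where
    enter   : Fin (Q zero) → Triangle D → Edge
    read    : ∀ i → Fin (Q i) → Letter → Fin (Q i) → Triangle D → Triangle D → Edge
    advance : ∀ j → Fin (Q (inject₁ j)) → Fin (Q (suc j)) → Triangle D → Triangle D → Edge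
    leave   : Fin (Q last) → Triangle D → Edge

  finite-State : Finite State
  finite-State = finite-retract
    (finite-⊎ finite-⊤ (finite-⊎ finite-⊤ (finite-× (finite-Σ (suc m) (finite-Fin ∘ Q)) (finite-Triangle D))))
    from⊎ to⊎ from-to
    where
    from⊎ : ⊤ ⊎ ⊤ ⊎ Σ (Fin (suc m)) (Fin ∘ Q) × Triangle D → State
    from⊎ (inj₁ _)                    = start
    from⊎ (inj₂ (inj₁ _))             = accept
    from⊎ (inj₂ (inj₂ ((i , q) , k))) = middle i q k
    to⊎ : State → ⊤ ⊎ ⊤ ⊎ Σ (Fin (suc m)) (Fin ∘ Q) × Triangle D
    to⊎ start          = inj₁ tt
    to⊎ accept         = inj₂ (inj₁ tt)
    to⊎ (middle i q k) = inj₂ (inj₂ ((i , q) , k))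
    from-to : ∀ s → from⊎ (to⊎ s) ≡ s
    from-to start          = refl
    from-to accept         = refl
    from-to (middle i q k) = refl

  Enter Read Advance Leave : Set
  Enter   = Fin (Q zero) × Triangle D
  Read    = Σ (Fin (suc m)) (λ i → Fin (Q i) × Letter × Fin (Q i)) × Triangle D × Triangle D
  Advance = Σ (Fin m) (λ j → Fin (Q (inject₁ j)) × Fin (Q (suc j))) × Triangle D × Triangle D
  Leave   = Fin (Q last) × Triangle D

  finite-Edge : Finite Edge
  finite-Edge = finite-retract
    (finite-⊎ (finite-× (finite-Fin _) (finite-Triangle D))
    (finite-⊎ (finite-× (finite-Σ (suc m) λ i → finite-× (finite-Fin (Q i)) (finite-× finite-Letter (finite-Fin (Q i))))
                        (finite-× (finite-Triangle D) (finite-Triangle D)))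
    (finite-⊎ (finite-× (finite-Σ m λ j → finite-× (finite-Fin (Q (inject₁ j))) (finite-Fin (Q (suc j))))
                        (finite-× (finite-Triangle D) (finite-Triangle D)))
              (finite-× (finite-Fin _) (finite-Triangle D)))))
    from⊎ to⊎ from-to
    where
    from⊎ : Enter ⊎ Read ⊎ Advance ⊎ Leave → Edge
    from⊎ (inj₁ (q , k))                                   = enter q k
    from⊎ (inj₂ (inj₁ ((i , q , x , q′) , kc , kn)))       = read i q x q′ kc kn
    from⊎ (inj₂ (inj₂ (inj₁ ((j , q , q′) , kc , kn))))   = advance j q q′ kc kn
    from⊎ (inj₂ (inj₂ (inj₂ (q , kc))))                   = leave q kc
    to⊎ : Edge → Enter ⊎ Read ⊎ Advance ⊎ Leave
    to⊎ (enter q k)            = inj₁ (q , k)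
    to⊎ (read i q x q′ kc kn)  = inj₂ (inj₁ ((i , q , x , q′) , kc , kn))
    to⊎ (advance j q q′ kc kn) = inj₂ (inj₂ (inj₁ ((j , q , q′) , kc , kn)))
    to⊎ (leave q kc)           = inj₂ (inj₂ (inj₂ (q , kc)))
    from-to : ∀ e → from⊎ (to⊎ e) ≡ e
    from-to (enter q k)            = refl
    from-to (read i q x q′ kc kn)  = refl
    from-to (advance j q q′ kc kn) = refl
    from-to (leave q kc)           = refl

  source target : Edge → State
  source (enter _ _)              = start
  source (read i q _ _ kc _)      = middle i q kc
  source (advance j q _ kc _)     = middle (inject₁ j) q kc
  source (leave q kc)             = middle last q kc
  target (enter q k)              = middle zero q k
  target (read i _ _ q′ _ kn)     = middle i q′ kn
  target (advance j _ q′ _ kn)    = middle (suc j) q′ kn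
  target (leave _ _)              = accept

  source-matrix target-matrix : Edge → Mat
  source-matrix (enter _ _)          = Mt
  source-matrix (read _ _ _ _ kc _)  = triangle kc
  source-matrix (advance _ _ _ kc _) = triangle kc
  source-matrix (leave _ kc)         = triangle kc
  target-matrix (enter _ k)          = triangle k
  target-matrix (read _ _ x _ _ kn)  = φL x ⊗ triangle kn
  target-matrix (advance j _ _ _ kn) = M (inject₁ j) ⊗ triangle kn
  target-matrix (leave _ _)          = M last

  core : Edge → List Letter
  core (enter _ k) = hermiteWord (Mt ∖ triangle k)
  core e           = hermiteWord (target-matrix e)

  -- φ (X ∷ X ∷ w) ≡ φ w: the padding only makes labels nonempty.
  label : Edge → List⁺ Letter
  label e = X ∷⁺ X ∷ core e

  Admissible : Edge → Set
  Admissible (enter q _)          = NFA.initial (𝒜 zero) q ≡ true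
  Admissible (read i q x q′ _ _)  = NFA.δ (𝒜 i) q x q′ ≡ true
  Admissible (advance j q q′ _ _) = NFA.final (𝒜 (inject₁ j)) q ≡ true × NFA.initial (𝒜 (suc j)) q′ ≡ true
  Admissible (leave q _)          = NFA.final (𝒜 last) q ≡ true

  admissible? : ∀ e → Dec (Admissible e)
  admissible? (enter q _)          = NFA.initial (𝒜 zero) q Bool.≟ true
  admissible? (read i q x q′ _ _)  = NFA.δ (𝒜 i) q x q′ Bool.≟ true
  admissible? (advance j q q′ _ _) =
    (NFA.final (𝒜 (inject₁ j)) q Bool.≟ true) ×-dec (NFA.initial (𝒜 (suc j)) q′ Bool.≟ true)
  admissible? (leave q _)          = NFA.final (𝒜 last) q Bool.≟ true

  Valid : Edge → Set
  Valid e = Admissible e × source-matrix e ⊗ φ (toList (label e)) ≡ target-matrix e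

  is-start is-accept : State → Bool
  is-start start = true
  is-start _     = false
  is-accept accept = true
  is-accept _      = false

  𝒲 : WordAutomaton
  𝒲 = record
    { State = State ; Edge = Edge ; finite-State = finite-State ; finite-Edge = finite-Edge
    ; Valid = Valid ; valid? = λ e → admissible? e ×-dec (_ ≟ᴹ _)
    ; source = source ; target = target ; label = label
    ; initial = is-start ; final = is-accept }

  open WordAutomaton-NFA 𝒲 public using (Path; []; edge; Accepts; accepts⇒∈L; ∈L⇒accepts) renaming (nfa to ℬ)

  F : (Fin (suc m) → List Letter) → Fin (suc m) → Mat
  F ws i = φ (ws i) ⊗ M i

  prodFrom-updateAt : ∀ ws i (f : List Letter → List Letter) →
                      prodFrom (F (updateAt ws i f)) i ≡ (φ (f (ws i)) ⊗ M i) ⊗ prodAfter (F ws) i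
  prodFrom-updateAt ws i f = cong₂ (λ v P → (φ v ⊗ M i) ⊗ P) (updateAt-updates i ws)
    (prodAfter-cong i λ j i<j → cong (λ v → φ v ⊗ M j) (updateAt-minimal j i ws (≢-sym (Fin.<⇒≢ i<j))))

  Later : (Fin (suc m) → List Letter) → Fin (suc m) → Set
  Later ws i = ∀ j → i Fin.< j → ws j ∈L 𝒜 j

  later-updateAt : ∀ ws i f → Later ws i → Later (updateAt ws i f) i
  later-updateAt ws i f later j i<j =
    subst (_∈L 𝒜 j) (sym (updateAt-minimal j i ws (≢-sym (Fin.<⇒≢ i<j)))) (later j i<j)

  Realised : ∀ i → Fin (Q i) → Triangle D → List Letter → Set
  Realised i q k w = ∃ λ ws → (∃ λ qf → Run (𝒜 i) q (ws i) qf × NFA.final (𝒜 i) qf ≡ true) ×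
                     Later ws i × triangle k ⊗ φ w ≡ prodFrom (F ws) i

  realised-read : ∀ {i q x q′ kc kn w} → Valid (read i q x q′ kc kn) → Realised i q′ kn w →
                  Realised i q kc (toList (label (read i q x q′ kc kn)) ++ w)
  realised-read {i} {q} {x} {q′} {kc} {kn} {w} (δ≡true , crosses) (ws , (qf , run , final≡) , later , reaches) =
    updateAt ws i (x ∷_) ,
    (qf , subst (λ v → Run (𝒜 i) q v qf) (sym (updateAt-updates i ws)) (step δ≡true run) , final≡) ,
    later-updateAt ws i (x ∷_) later ,
    ⊗-φ-++ (triangle kc) (toList (label (read i q x q′ kc kn))) w crosses (begin
      (φL x ⊗ triangle kn) ⊗ φ w               ≡⟨ ⊗-assoc (φL x) (triangle kn) (φ w) ⟩
      φL x ⊗ (triangle kn ⊗ φ w)               ≡⟨ cong (φL x ⊗_) reaches ⟩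
      φL x ⊗ ((φ (ws i) ⊗ M i) ⊗ rest)            ≡⟨ sym (⊗-assoc (φL x) (φ (ws i) ⊗ M i) rest) ⟩
      (φL x ⊗ (φ (ws i) ⊗ M i)) ⊗ rest            ≡⟨ cong (_⊗ rest) (⊗-assoc (φL x) (φ (ws i)) (M i)) ⟨
      (φ (x ∷ ws i) ⊗ M i) ⊗ rest                 ≡⟨ sym (prodFrom-updateAt ws i (x ∷_)) ⟩
      prodFrom (F (updateAt ws i (x ∷_))) i    ∎)
    where
    open ≡-Reasoning
    rest : Mat
    rest = prodAfter (F ws) i

  realised-advance : ∀ {j q q′ kc kn w} → Valid (advance j q q′ kc kn) → Realised (suc j) q′ kn w →
                     Realised (inject₁ j) q kc (toList (label (advance j q q′ kc kn)) ++ w)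
  realised-advance {j} {q} {q′} {kc} {kn} {w}
                   ((final≡ , initial≡) , crosses) (ws , (qf , run , final′≡) , later , reaches) =
    updateAt ws j′ (const []) ,
    (q , subst (λ v → Run (𝒜 j′) q v q) (sym (updateAt-updates j′ ws)) done , final≡) ,
    later-updateAt ws j′ (const []) later′ ,
    ⊗-φ-++ (triangle kc) (toList (label (advance j q q′ kc kn))) w crosses (begin
      (M j′ ⊗ triangle kn) ⊗ φ w               ≡⟨ ⊗-assoc (M j′) (triangle kn) (φ w) ⟩
      M j′ ⊗ (triangle kn ⊗ φ w)               ≡⟨ cong (M j′ ⊗_) reaches ⟩
      M j′ ⊗ prodFrom (F ws) (suc j)           ≡⟨ cong (M j′ ⊗_) (prodAfter-inject₁ (F ws) j) ⟨
      M j′ ⊗ rest                                 ≡⟨ cong (_⊗ rest) (sym (⊗-identityˡ (M j′))) ⟩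
      (φ [] ⊗ M j′) ⊗ rest                        ≡⟨ sym (prodFrom-updateAt ws j′ (const [])) ⟩
      prodFrom (F (updateAt ws j′ (const []))) j′ ∎)
    where
    open ≡-Reasoning
    j′ : Fin (suc m)
    j′ = inject₁ j
    rest : Mat
    rest = prodAfter (F ws) j′
    later′ : Later ws j′
    later′ l j′<l with inject₁<⇒≡suc⊎suc< j′<l
    ... | inj₁ refl    = q′ , qf , initial≡ , run , final′≡
    ... | inj₂ suc-j<l = later l suc-j<l

  realised-leave : ∀ {q kc} → Valid (leave q kc) → Realised last q kc (toList (label (leave q kc)) ++ [])
  realised-leave {q} {kc} (final≡ , crosses) =
    const [] , (q , done , final≡) , (λ j last<j → contradiction (Fin.≤fromℕ j) (ℕ.<⇒≱ last<j)) ,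
    ⊗-φ-++ (triangle kc) (toList (label (leave q kc))) [] crosses
      (cong₂ _⊗_ (sym (⊗-identityˡ (M last))) (sym (prodAfter-last m (F (const [])))))

  source≢accept : ∀ e → source e ≢ accept
  source≢accept (enter _ _)          ()
  source≢accept (read _ _ _ _ _ _)   ()
  source≢accept (advance _ _ _ _ _)  ()
  source≢accept (leave _ _)          ()

  realised : ∀ {i q k w} → Path (middle i q k) w accept → Realised i q k w
  realised (edge (read i q x q′ kc kn) valid refl path) =
    realised-read {i} {q} {x} {q′} {kc} {kn} valid (realised path)
  realised (edge (advance j q q′ kc kn) valid refl path) =
    realised-advance {j} {q} {q′} {kc} {kn} valid (realised path)
  realised (edge (leave q kc) valid refl [])             = realised-leave {q} {kc} valid
  realised (edge (leave _ _) _ refl (edge e _ source≡accept _)) = contradiction source≡accept (source≢accept e)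

  Sound : List Letter → Set
  Sound w = Σ (Fin (suc m) → List Letter) λ ws →
              (∀ i → ws i ∈L 𝒜 i) × prod (suc m) (F ws) ⊗ inv (φ w) ≡ Mt

  sound-enter : ∀ {q k w} → Valid (enter q k) → Realised zero q k w → Sound (toList (label (enter q k)) ++ w)
  sound-enter {q} {k} {w} (initial≡ , crosses) (ws , (qf , run , final≡) , later , reaches) =
    ws , accepted ,
    ⊗φ⇒⊗inv Mt (toList (label (enter q k)) ++ w) (prod (suc m) (F ws))
            (⊗-φ-++ Mt (toList (label (enter q k))) w crosses reaches)
    where
    accepted : ∀ i → ws i ∈L 𝒜 i
    accepted zero    = q , qf , initial≡ , run , final≡
    accepted (suc j) = later (suc j) ℕ.z<s

  sound : ∀ {w} → Accepts w → Sound w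
  sound (start , accept , _ , edge (enter q k) valid refl path , _) = sound-enter {q} {k} valid (realised path)

  record Reaches (i : Fin (suc m)) (q : Fin (Q i)) (T : Mat) : Set where
    constructor reaching
    field
      k       : Triangle D
      w       : List Letter
      path    : Path (middle i q k) w accept
      reaches : triangle k ⊗ φ w ≡ T
      ∣k∣≡Dᵢ  : ∣ det (triangle k) ∣ ≡ Dᵢ i

  -- Opaque, so that functions returning reaches-≡ … are not normalised into ring-solver proofs.
  opaque
    reaches-≡ : ∀ {i q T T′} → T ≡ T′ → Reaches i q T → Reaches i q T′
    reaches-≡ refl r = r

  reaches-read : ∀ {i q x q′ T} → NFA.δ (𝒜 i) q x q′ ≡ true → Reaches i q′ T → Reaches i q (φL x ⊗ T)
  reaches-read {i} {q} {x} {q′} {T} δ≡true (reaching kn w path reaches ∣kn∣≡Dᵢ) =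
    with-triangle (triangle-for i K′ (trans (∣det∣-⊗-GLˡ (φL x) (triangle kn) (φL-GL x)) ∣kn∣≡Dᵢ))
    where
    K′ : Mat
    K′ = φL x ⊗ triangle kn
    with-triangle : HermiteTriangle i K′ → Reaches i q (φL x ⊗ T)
    with-triangle (kc , reduces , ∣kc∣≡Dᵢ) =
      reaching kc (toList (label e) ++ w) (edge e (δ≡true , crosses) refl path)
        (⊗-φ-++ (triangle kc) (toList (label e)) w crosses
          (trans (⊗-assoc (φL x) (triangle kn) (φ w)) (cong (φL x ⊗_) reaches)))
        ∣kc∣≡Dᵢ
      where
      e : Edge
      e = read i q x q′ kc kn
      crosses : triangle kc ⊗ φ (toList (label e)) ≡ K′
      crosses = ⊗-φ-XX (triangle kc) (hermiteWord K′) reduces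

  reaches-run : ∀ {i q v qf T} → Run (𝒜 i) q v qf → Reaches i qf T → Reaches i q (φ v ⊗ T)
  reaches-run {T = T} done r = reaches-≡ (sym (⊗-identityˡ T)) r
  reaches-run {i} {q} {x ∷ v} {T = T} (step {q' = q′} δ≡true run) r =
    reaches-≡ (sym (⊗-assoc (φL x) (φ v) T))
              (reaches-read {i} {q} {x} {q′} {φ v ⊗ T} δ≡true (reaches-run run r))

  reaches-advance : ∀ {j q q′ T} →
                    NFA.final (𝒜 (inject₁ j)) q ≡ true → NFA.initial (𝒜 (suc j)) q′ ≡ true →
                    Reaches (suc j) q′ T → Reaches (inject₁ j) q (M (inject₁ j) ⊗ T)
  reaches-advance {j} {q} {q′} {T} final≡ initial≡ (reaching kn w path reaches ∣kn∣≡Dᵢ) =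
    with-triangle (triangle-for j′ K′ (begin
      ∣ det (M j′ ⊗ triangle kn) ∣             ≡⟨ ∣det∣-⊗ (M j′) (triangle kn) ⟩
      ∣ det (M j′) ∣ ℕ.* ∣ det (triangle kn) ∣ ≡⟨ cong (∣ det (M j′) ∣ ℕ.*_) ∣kn∣≡Dᵢ ⟩
      ∣ det (M j′) ∣ ℕ.* Dᵢ (suc j)            ≡⟨ Dᵢ-inject₁ j ⟨
      Dᵢ j′                                    ∎))
    where
    open ≡-Reasoning
    j′ : Fin (suc m)
    j′ = inject₁ j
    K′ : Mat
    K′ = M j′ ⊗ triangle kn
    with-triangle : HermiteTriangle j′ K′ → Reaches j′ q (M j′ ⊗ T)
    with-triangle (kc , reduces , ∣kc∣≡Dᵢ) =
      reaching kc (toList (label e) ++ w) (edge e ((final≡ , initial≡) , crosses) refl path)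
        (⊗-φ-++ (triangle kc) (toList (label e)) w crosses
          (trans (⊗-assoc (M j′) (triangle kn) (φ w)) (cong (M j′ ⊗_) reaches)))
        ∣kc∣≡Dᵢ
      where
      e : Edge
      e = advance j q q′ kc kn
      crosses : triangle kc ⊗ φ (toList (label e)) ≡ K′
      crosses = ⊗-φ-XX (triangle kc) (hermiteWord K′) reduces

  reaches-leave : ∀ {q} → NFA.final (𝒜 last) q ≡ true → Reaches last q (M last)
  reaches-leave {q} final≡ = with-triangle (triangle-for last (M last) (sym Dᵢ-last))
    where
    with-triangle : HermiteTriangle last (M last) → Reaches last q (M last)
    with-triangle (kc , reduces , ∣kc∣≡Dᵢ) =
      reaching kc (toList (label e) ++ []) (edge e (final≡ , crosses) refl [])
        (⊗-φ-++ (triangle kc) (toList (label e)) [] crosses (⊗-identityʳ (M last)))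
        ∣kc∣≡Dᵢ
      where
      e : Edge
      e = leave q kc
      crosses : triangle kc ⊗ φ (toList (label e)) ≡ M last
      crosses = ⊗-φ-XX (triangle kc) (hermiteWord (M last)) reduces

  module _ (ws : Fin (suc m) → List Letter) (accepted : ∀ i → ws i ∈L 𝒜 i) where

    Exits : Fin (suc m) → Set
    Exits i = ∀ qf → NFA.final (𝒜 i) qf ≡ true → Reaches i qf (M i ⊗ prodAfter (F ws) i)

    Entry : Fin (suc m) → Set
    Entry i = ∃ λ q → NFA.initial (𝒜 i) q ≡ true × Reaches i q (prodFrom (F ws) i)

    entry : ∀ i → Exits i → Entry i
    entry i exits = entry-from (accepted i)
      where
      entry-from : ws i ∈L 𝒜 i → Entry i
      entry-from (q , qf , initial≡ , run , final≡) =
        q , initial≡ ,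
        reaches-≡ (sym (⊗-assoc (φ (ws i)) (M i) (prodAfter (F ws) i))) (reaches-run run (exits qf final≡))

    exits-last : Exits last
    exits-last qf final≡ =
      reaches-≡ (trans (sym (⊗-identityʳ (M last))) (cong (M last ⊗_) (sym (prodAfter-last m (F ws)))))
                (reaches-leave final≡)

    exits-advance : ∀ j → Entry (suc j) → Exits (inject₁ j)
    exits-advance j (q′ , initial≡ , r) qf final≡ =
      reaches-≡ (cong (M (inject₁ j) ⊗_) (sym (prodAfter-inject₁ (F ws) j))) (reaches-advance final≡ initial≡ r)

    entry₀ : Entry zero
    entry₀ = >-weakInduction Entry (entry last exits-last) (λ j → entry (inject₁ j) ∘ exits-advance j) zero

    Complete : Set
    Complete = ∃ λ w → w ∈L ℬ × prod (suc m) (F ws) ⊗ inv (φ w) ≡ Mt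

    complete-enter : ∀ A → InGL2 A → prod (suc m) (F ws) ⊗ A ≡ Mt → Entry zero → Complete
    complete-enter A A-GL PA≡Mt (q , initial≡ , reaching k w path reaches _) =
      toList (label e) ++ w ,
      accepts⇒∈L (start , accept , refl , edge e (initial≡ , enters) refl path , refl) ,
      ⊗φ⇒⊗inv Mt (toList (label e) ++ w) P (⊗-φ-++ Mt (toList (label e)) w enters reaches)
      where
      e : Edge
      e = enter q k
      P H : Mat
      P = prod (suc m) (F ws)
      H = inv A ⊗ inv (φ w)
      H-GL : InGL2 H
      H-GL = GL-⊗ (inv A) (inv (φ w)) (inv-GL A A-GL) (inv-GL (φ w) (φ-GL w))
      k≡MtH : triangle k ≡ Mt ⊗ H
      k≡MtH = begin
        triangle k                 ≡⟨ ⊗-cancelʳ (triangle k) (φ w) P (φ-GL w) reaches ⟩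
        P ⊗ inv (φ w)              ≡⟨ cong (_⊗ inv (φ w)) (⊗-cancelʳ P A Mt A-GL PA≡Mt) ⟩
        (Mt ⊗ inv A) ⊗ inv (φ w)   ≡⟨ ⊗-assoc Mt (inv A) (inv (φ w)) ⟩
        Mt ⊗ H                     ∎
        where open ≡-Reasoning
      Mt∖k≡H : Mt ∖ triangle k ≡ H
      Mt∖k≡H = trans (cong (Mt ∖_) k≡MtH) (∖-⊗ Mt H)
      Mt∖k-GL : InGL2 (Mt ∖ triangle k)
      Mt∖k-GL = subst InGL2 (sym Mt∖k≡H) H-GL
      enters : Mt ⊗ φ (X ∷ X ∷ hermiteWord (Mt ∖ triangle k)) ≡ triangle k
      enters = ⊗-φ-XX Mt (hermiteWord (Mt ∖ triangle k)) (begin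
        Mt ⊗ φ (hermiteWord (Mt ∖ triangle k))  ≡⟨ cong (Mt ⊗_) (φ-surjective (Mt ∖ triangle k) Mt∖k-GL) ⟩
        Mt ⊗ (Mt ∖ triangle k)                  ≡⟨ cong (Mt ⊗_) Mt∖k≡H ⟩
        Mt ⊗ H                                  ≡⟨ sym k≡MtH ⟩
        triangle k                              ∎)
        where open ≡-Reasoning

    complete : (∃ λ A → InGL2 A × prod (suc m) (F ws) ⊗ A ≡ Mt) → Complete
    complete (A , A-GL , PA≡Mt) = complete-enter A A-GL PA≡Mt entry₀

proposition6 : (t : ℕ) → 2 ≤ t →
  (𝒜 : Fin (t ∸ 1) → NFA) → (M : Fin (t ∸ 1) → Mat) → (Mt : Mat) →
  ((i : Fin (t ∸ 1)) → Nonsingular (M i)) → Nonsingular Mt →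
  Σ NFA λ ℬ →
    ((ws : Fin (t ∸ 1) → List Letter) → ((i : Fin (t ∸ 1)) → ws i ∈L 𝒜 i) →
      (Σ Mat λ A → InGL2 A × (prod (t ∸ 1) (λ i → φ (ws i) ⊗ M i) ⊗ A ≡ Mt)) →
      Σ (List Letter) λ w → w ∈L ℬ × (prod (t ∸ 1) (λ i → φ (ws i) ⊗ M i) ⊗ inv (φ w) ≡ Mt))
    ×
    ((w : List Letter) → w ∈L ℬ →
      Σ (Fin (t ∸ 1) → List Letter) λ ws → ((i : Fin (t ∸ 1)) → ws i ∈L 𝒜 i) ×
        (prod (t ∸ 1) (λ i → φ (ws i) ⊗ M i) ⊗ inv (φ w) ≡ Mt))
proposition6 (suc (suc m)) _ 𝒜 M Mt M-nonsingular Mt-nonsingular =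
  ℬ , complete , λ w w∈ℬ → sound (∈L⇒accepts w∈ℬ)
  where open Construction 𝒜 M Mt M-nonsingular Mt-nonsingular
proposition6 (suc zero) (s≤s ())
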